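{- For all $w\in F_2$, $\mathrm{Pal}(w)=a^{ -1}b^{ -1}R_w(ba)$ and $E(\mathrm{Pal}(w))=\mathrm{Pal}(E(w))$.
   Context: $F_2$ is the free group on $a,b$. $w\mapsto R_w$ is the group homomorphism $F_2\to\mathrm{Aut}(F_2)$ with $R_a(a)=a$, $R_a(b)=ba$, $R_b(a)=ab$, $R_b(b)=b$. The palindromization map $\mathrm{Pal}:F_2\to F_2$ is defined by $\mathrm{Pal}(w)=b^{ -1}a^{ -1}R_w(ab)$. $E$ is the automorphism of $F_2$ exchanging $a$ and $b$. -}

module Defs where

open import Data.List using (List; []; _∷_; _++_; foldr; reverse; map; concatMap)
open import Relation.Binary.PropositionalEquality using (_≡_)

-- The free group F₂ on a, b, realised as words in the letters a, a⁻¹, b, b⁻¹,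
-- two words representing the same element iff their free reductions agree.
data Letter : Set where
  a⁺ a⁻ b⁺ b⁻ : Letter

Word : Set
Word = List Letter

invL : Letter → Letter
invL a⁺ = a⁻
invL a⁻ = a⁺
invL b⁺ = b⁻
invL b⁻ = b⁺

inv : Word → Word
inv w = reverse (map invL w)

push : Letter → Word → Word
push a⁺ (a⁻ ∷ ys) = ys
push a⁻ (a⁺ ∷ ys) = ys
push b⁺ (b⁻ ∷ ys) = ys
push b⁻ (b⁺ ∷ ys) = ys
push x ys = x ∷ ys

reduce : Word → Word
reduce = foldr push []

infix 4 _≈_
_≈_ : Word → Word → Set
u ≈ v = reduce u ≡ reduce v

a b a⁻¹ b⁻¹ : Word
a = a⁺ ∷ []
b = b⁺ ∷ []
a⁻¹ = a⁻ ∷ []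
b⁻¹ = b⁻ ∷ []

subst : Word → Word → Word → Word
subst ia ib [] = []
subst ia ib (a⁺ ∷ w) = ia ++ subst ia ib w
subst ia ib (a⁻ ∷ w) = inv ia ++ subst ia ib w
subst ia ib (b⁺ ∷ w) = ib ++ subst ia ib w
subst ia ib (b⁻ ∷ w) = inv ib ++ subst ia ib w

-- R on letters: R_a(a)=a, R_a(b)=ba; R_b(a)=ab, R_b(b)=b;
-- R_{a⁻¹} = R_a⁻¹ : a ↦ a, b ↦ b a⁻¹;  R_{b⁻¹} = R_b⁻¹ : a ↦ a b⁻¹, b ↦ b.
RL : Letter → Word → Word
RL a⁺ = subst a (b ++ a)
RL a⁻ = subst a (b ++ a⁻¹)
RL b⁺ = subst (a ++ b) b
RL b⁻ = subst (a ++ b⁻¹) b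

R : Word → Word → Word
R [] x = x
R (l ∷ w) x = RL l (R w x)

Pal : Word → Word
Pal w = b⁻¹ ++ a⁻¹ ++ R w (a ++ b)

E : Word → Word
E = subst b a

module Submission where

-- Both claims are identities in F₂, i.e. equalities of free
-- reductions of words.
--  (1) Each generator automorphism R_a, R_b (and their inverses) fixes the
--      commutator C = a b a⁻¹ b⁻¹, hence so does every R_w.  Since
--      a b = C · b a in F₂, we get R_w(ab) = C · R_w(ba), and
--      b⁻¹ a⁻¹ C = a⁻¹ b⁻¹ gives Pal(w) = a⁻¹ b⁻¹ R_w(ba).
--  (2) E conjugates each R_l to R_{E(l)}, so E ∘ R_w = R_{E(w)} ∘ E literally
--      on words; thus E(Pal w) = a⁻¹ b⁻¹ R_{E w}(ba), which is Pal(E w) by (1).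

open import Defs
open import Data.List using ([]; _∷_; _++_; foldr; reverse; map)
open import Data.List.Properties using (++-assoc; ++-identityʳ; foldr-++; reverse-++; unfold-reverse; map-++)
open import Data.Product using (_×_; _,_)
open import Data.Unit using (⊤; tt)
open import Data.Empty using (⊥-elim)
open import Relation.Nullary using (¬_)
open import Relation.Binary.PropositionalEquality using (_≡_; refl; sym; trans; cong; cong₂; module ≡-Reasoning)

invL-involutive : ∀ x → invL (invL x) ≡ x
invL-involutive a⁺ = refl
invL-involutive a⁻ = refl
invL-involutive b⁺ = refl
invL-involutive b⁻ = refl

Reduced : Word → Set
Reduced [] = ⊤
Reduced (x ∷ []) = ⊤
Reduced (x ∷ y ∷ ys) = (¬ y ≡ invL x) × Reduced (y ∷ ys)

Reduced-tail : ∀ y ys → Reduced (y ∷ ys) → Reduced ys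
Reduced-tail y [] _ = tt
Reduced-tail y (z ∷ ys) (_ , r) = r

data PushView (x : Letter) (ys : Word) : Set where
  cancels : ∀ ys' → ys ≡ invL x ∷ ys' → push x ys ≡ ys' → PushView x ys
  conses  : (∀ ys' → ¬ ys ≡ invL x ∷ ys') → push x ys ≡ x ∷ ys → PushView x ys

push-view : ∀ x ys → PushView x ys
push-view x [] = conses (λ _ ()) (push-[] x)
  where
  push-[] : ∀ x → push x [] ≡ x ∷ []
  push-[] a⁺ = refl
  push-[] a⁻ = refl
  push-[] b⁺ = refl
  push-[] b⁻ = refl
push-view a⁺ (a⁺ ∷ ys) = conses (λ _ ()) refl
push-view a⁺ (a⁻ ∷ ys) = cancels ys refl refl
push-view a⁺ (b⁺ ∷ ys) = conses (λ _ ()) refl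
push-view a⁺ (b⁻ ∷ ys) = conses (λ _ ()) refl
push-view a⁻ (a⁺ ∷ ys) = cancels ys refl refl
push-view a⁻ (a⁻ ∷ ys) = conses (λ _ ()) refl
push-view a⁻ (b⁺ ∷ ys) = conses (λ _ ()) refl
push-view a⁻ (b⁻ ∷ ys) = conses (λ _ ()) refl
push-view b⁺ (a⁺ ∷ ys) = conses (λ _ ()) refl
push-view b⁺ (a⁻ ∷ ys) = conses (λ _ ()) refl
push-view b⁺ (b⁺ ∷ ys) = conses (λ _ ()) refl
push-view b⁺ (b⁻ ∷ ys) = cancels ys refl refl
push-view b⁻ (a⁺ ∷ ys) = conses (λ _ ()) refl
push-view b⁻ (a⁻ ∷ ys) = conses (λ _ ()) refl
push-view b⁻ (b⁺ ∷ ys) = cancels ys refl refl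
push-view b⁻ (b⁻ ∷ ys) = conses (λ _ ()) refl

push-Reduced : ∀ x ys → Reduced ys → Reduced (push x ys)
push-Reduced x ys r with push-view x ys
... | cancels ys' refl eq rewrite eq = Reduced-tail _ ys' r
push-Reduced x [] r | conses ne eq rewrite eq = tt
push-Reduced x (y ∷ ys) r | conses ne eq rewrite eq = (λ e → ne ys (cong (_∷ ys) e)) , r

push-invL-∷ : ∀ x ys → push x (invL x ∷ ys) ≡ ys
push-invL-∷ a⁺ ys = refl
push-invL-∷ a⁻ ys = refl
push-invL-∷ b⁺ ys = refl
push-invL-∷ b⁻ ys = refl

push-cancel : ∀ x ys → Reduced ys → push x (push (invL x) ys) ≡ ys
push-cancel x ys r with push-view (invL x) ys
push-cancel x ys r | conses _ eq rewrite eq = push-invL-∷ x ys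
push-cancel x .(invL (invL x) ∷ ys') r | cancels ys' refl eq rewrite eq with push-view x ys'
... | conses _ eq₂ rewrite eq₂ = cong (_∷ ys') (sym (invL-involutive x))
push-cancel x .(invL (invL x) ∷ invL x ∷ ys'') (ne , _) | cancels .(invL x ∷ ys'') refl _ | cancels ys'' refl _ =
  ⊥-elim (ne (sym (invL-involutive (invL x))))

act : Word → Word → Word
act u ys = foldr push ys u

act-Reduced : ∀ u ys → Reduced ys → Reduced (act u ys)
act-Reduced [] ys r = r
act-Reduced (x ∷ u) ys r = push-Reduced x _ (act-Reduced u ys r)

reduce-Reduced : ∀ u → Reduced (reduce u)
reduce-Reduced u = act-Reduced u [] tt

act-push : ∀ x u ys → Reduced ys → act (push x u) ys ≡ push x (act u ys)
act-push x u ys r with push-view x u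
... | cancels u' refl eq rewrite eq = sym (push-cancel x (act u' ys) (act-Reduced u' ys r))
... | conses _ eq rewrite eq = refl

act-reduce : ∀ u ys → Reduced ys → act u ys ≡ act (reduce u) ys
act-reduce [] ys r = refl
act-reduce (x ∷ u) ys r = trans (cong (push x) (act-reduce u ys r)) (sym (act-push x (reduce u) ys r))

reduce-++ : ∀ u v → reduce (u ++ v) ≡ act u (reduce v)
reduce-++ [] v = refl
reduce-++ (x ∷ u) v = cong (push x) (reduce-++ u v)

≈-++ˡ : ∀ u u' v → u ≈ u' → (u ++ v) ≈ (u' ++ v)
≈-++ˡ u u' v e = begin
    reduce (u ++ v)          ≡⟨ reduce-++ u v ⟩
    act u (reduce v)         ≡⟨ act-reduce u _ (reduce-Reduced v) ⟩
    act (reduce u) (reduce v)  ≡⟨ cong (λ z → act z (reduce v)) e ⟩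
    act (reduce u') (reduce v) ≡⟨ sym (act-reduce u' _ (reduce-Reduced v)) ⟩
    act u' (reduce v)        ≡⟨ sym (reduce-++ u' v) ⟩
    reduce (u' ++ v)         ∎
  where open ≡-Reasoning

≈-++ʳ : ∀ u v v' → v ≈ v' → (u ++ v) ≈ (u ++ v')
≈-++ʳ u v v' e = trans (reduce-++ u v) (trans (cong (act u) e) (sym (reduce-++ u v')))

inv-++ : ∀ u v → inv (u ++ v) ≡ inv v ++ inv u
inv-++ u v = trans (cong reverse (map-++ invL u v)) (reverse-++ (map invL u) (map invL v))

inv-∷ : ∀ x u → inv (x ∷ u) ≡ inv u ++ (invL x ∷ [])
inv-∷ x u = unfold-reverse (invL x) (map invL u)

inv-involutive : ∀ u → inv (inv u) ≡ u
inv-involutive [] = refl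
inv-involutive (x ∷ u) = begin
    inv (inv (x ∷ u))                ≡⟨ cong inv (inv-∷ x u) ⟩
    inv (inv u ++ (invL x ∷ []))     ≡⟨ inv-++ (inv u) (invL x ∷ []) ⟩
    invL (invL x) ∷ inv (inv u)      ≡⟨ cong₂ _∷_ (invL-involutive x) (inv-involutive u) ⟩
    x ∷ u                            ∎
  where open ≡-Reasoning

act-inv : ∀ u ys → Reduced ys → act u (act (inv u) ys) ≡ ys
act-inv [] ys r = refl
act-inv (x ∷ u) ys r = begin
    push x (act u (act (inv (x ∷ u)) ys))
      ≡⟨ cong (λ z → push x (act u (act z ys))) (inv-∷ x u) ⟩
    push x (act u (act (inv u ++ (invL x ∷ [])) ys))
      ≡⟨ cong (λ z → push x (act u z)) (foldr-++ push ys (inv u) (invL x ∷ [])) ⟩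
    push x (act u (act (inv u) (push (invL x) ys)))
      ≡⟨ cong (push x) (act-inv u _ (push-Reduced (invL x) ys r)) ⟩
    push x (push (invL x) ys)
      ≡⟨ push-cancel x ys r ⟩
    ys ∎
  where open ≡-Reasoning

inv-cancel : ∀ u v → (u ++ inv u ++ v) ≈ v
inv-cancel u v = begin
    reduce (u ++ inv u ++ v)          ≡⟨ reduce-++ u (inv u ++ v) ⟩
    act u (reduce (inv u ++ v))       ≡⟨ cong (act u) (reduce-++ (inv u) v) ⟩
    act u (act (inv u) (reduce v))    ≡⟨ act-inv u _ (reduce-Reduced v) ⟩
    reduce v                          ∎
  where open ≡-Reasoning

module _ (ia ib : Word) where

  img : Letter → Word
  img a⁺ = ia
  img a⁻ = inv ia
  img b⁺ = ib
  img b⁻ = inv ib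

  subst-∷ : ∀ x w → subst ia ib (x ∷ w) ≡ img x ++ subst ia ib w
  subst-∷ a⁺ w = refl
  subst-∷ a⁻ w = refl
  subst-∷ b⁺ w = refl
  subst-∷ b⁻ w = refl

  img-invL : ∀ x → img (invL x) ≡ inv (img x)
  img-invL a⁺ = refl
  img-invL a⁻ = sym (inv-involutive ia)
  img-invL b⁺ = refl
  img-invL b⁻ = sym (inv-involutive ib)

  subst-++ : ∀ u v → subst ia ib (u ++ v) ≡ subst ia ib u ++ subst ia ib v
  subst-++ [] v = refl
  subst-++ (x ∷ u) v = begin
      subst ia ib (x ∷ u ++ v)                        ≡⟨ subst-∷ x (u ++ v) ⟩
      img x ++ subst ia ib (u ++ v)                   ≡⟨ cong (img x ++_) (subst-++ u v) ⟩
      img x ++ subst ia ib u ++ subst ia ib v         ≡⟨ sym (++-assoc (img x) _ _) ⟩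
      (img x ++ subst ia ib u) ++ subst ia ib v       ≡⟨ cong (_++ subst ia ib v) (sym (subst-∷ x u)) ⟩
      subst ia ib (x ∷ u) ++ subst ia ib v            ∎
    where open ≡-Reasoning

  subst-inv : ∀ u → subst ia ib (inv u) ≡ inv (subst ia ib u)
  subst-inv [] = refl
  subst-inv (x ∷ u) = begin
      subst ia ib (inv (x ∷ u))                         ≡⟨ cong (subst ia ib) (inv-∷ x u) ⟩
      subst ia ib (inv u ++ (invL x ∷ []))              ≡⟨ subst-++ (inv u) _ ⟩
      subst ia ib (inv u) ++ subst ia ib (invL x ∷ [])  ≡⟨ cong₂ _++_ (subst-inv u) (subst-∷ (invL x) []) ⟩
      inv (subst ia ib u) ++ img (invL x) ++ []         ≡⟨ cong (inv (subst ia ib u) ++_) (trans (++-identityʳ _) (img-invL x)) ⟩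
      inv (subst ia ib u) ++ inv (img x)                ≡⟨ sym (inv-++ (img x) (subst ia ib u)) ⟩
      inv (img x ++ subst ia ib u)                      ≡⟨ cong inv (sym (subst-∷ x u)) ⟩
      inv (subst ia ib (x ∷ u))                         ∎
    where open ≡-Reasoning

  -- a cancellation performed by push is also a cancellation in the image
  subst-push : ∀ x u → subst ia ib (push x u) ≈ img x ++ subst ia ib u
  subst-push x u with push-view x u
  ... | conses _ eq rewrite eq | subst-∷ x u = refl
  ... | cancels u' refl eq rewrite eq | subst-∷ (invL x) u' | img-invL x =
    sym (inv-cancel (img x) (subst ia ib u'))

  subst-reduce : ∀ u → subst ia ib u ≈ subst ia ib (reduce u)
  subst-reduce [] = refl
  subst-reduce (x ∷ u) = begin
      reduce (subst ia ib (x ∷ u))              ≡⟨ cong reduce (subst-∷ x u) ⟩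
      reduce (img x ++ subst ia ib u)           ≡⟨ ≈-++ʳ (img x) _ _ (subst-reduce u) ⟩
      reduce (img x ++ subst ia ib (reduce u))  ≡⟨ sym (subst-push x (reduce u)) ⟩
      reduce (subst ia ib (push x (reduce u)))  ∎
    where open ≡-Reasoning

  subst-resp : ∀ u v → u ≈ v → subst ia ib u ≈ subst ia ib v
  subst-resp u v e =
    trans (subst-reduce u) (trans (cong (λ z → reduce (subst ia ib z)) e) (sym (subst-reduce v)))

subst-∘ : ∀ f g ia ib z → subst f g (subst ia ib z) ≡ subst (subst f g ia) (subst f g ib) z
subst-∘ f g ia ib [] = refl
subst-∘ f g ia ib (a⁺ ∷ z) = trans (subst-++ f g ia _) (cong (subst f g ia ++_) (subst-∘ f g ia ib z))
subst-∘ f g ia ib (a⁻ ∷ z) = trans (subst-++ f g (inv ia) _) (cong₂ _++_ (subst-inv f g ia) (subst-∘ f g ia ib z))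
subst-∘ f g ia ib (b⁺ ∷ z) = trans (subst-++ f g ib _) (cong (subst f g ib ++_) (subst-∘ f g ia ib z))
subst-∘ f g ia ib (b⁻ ∷ z) = trans (subst-++ f g (inv ib) _) (cong₂ _++_ (subst-inv f g ib) (subst-∘ f g ia ib z))

RL-++ : ∀ l u v → RL l (u ++ v) ≡ RL l u ++ RL l v
RL-++ a⁺ = subst-++ _ _
RL-++ a⁻ = subst-++ _ _
RL-++ b⁺ = subst-++ _ _
RL-++ b⁻ = subst-++ _ _

R-++ : ∀ w u v → R w (u ++ v) ≡ R w u ++ R w v
R-++ [] u v = refl
R-++ (l ∷ w) u v = trans (cong (RL l) (R-++ w u v)) (RL-++ l (R w u) (R w v))

RL-resp : ∀ l u v → u ≈ v → RL l u ≈ RL l v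
RL-resp a⁺ = subst-resp _ _
RL-resp a⁻ = subst-resp _ _
RL-resp b⁺ = subst-resp _ _
RL-resp b⁻ = subst-resp _ _

R-resp : ∀ w u v → u ≈ v → R w u ≈ R w v
R-resp [] u v e = e
R-resp (l ∷ w) u v e = RL-resp l _ _ (R-resp w u v e)

commutator : Word
commutator = a⁺ ∷ b⁺ ∷ a⁻ ∷ b⁻ ∷ []

-- Every R_w fixes the commutator: each generator does, by computation.
R-commutator : ∀ w → R w commutator ≈ commutator
R-commutator [] = refl
R-commutator (l ∷ w) = trans (RL-resp l _ _ (R-commutator w)) (RL-commutator l)
  where
  RL-commutator : ∀ l → RL l commutator ≈ commutator
  RL-commutator a⁺ = refl
  RL-commutator a⁻ = refl
  RL-commutator b⁺ = refl
  RL-commutator b⁻ = refl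

-- R_w(ab) = [a,b] · R_w(ba), since ab = [a,b] · ba.
R-ab : ∀ w → R w (a ++ b) ≈ commutator ++ R w (b ++ a)
R-ab w = begin
    reduce (R w (a ++ b))                       ≡⟨ R-resp w (a ++ b) (commutator ++ b ++ a) refl ⟩
    reduce (R w (commutator ++ b ++ a))         ≡⟨ cong reduce (R-++ w commutator (b ++ a)) ⟩
    reduce (R w commutator ++ R w (b ++ a))     ≡⟨ ≈-++ˡ (R w commutator) commutator (R w (b ++ a)) (R-commutator w) ⟩
    reduce (commutator ++ R w (b ++ a))         ∎
  where open ≡-Reasoning

Pal-ba : ∀ w → Pal w ≈ a⁻¹ ++ b⁻¹ ++ R w (b ++ a)
Pal-ba w = trans (≈-++ʳ (b⁻¹ ++ a⁻¹) (R w (a ++ b)) (commutator ++ R w (b ++ a)) (R-ab w))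
                 (≈-++ˡ (b⁻¹ ++ a⁻¹ ++ commutator) (a⁻¹ ++ b⁻¹) (R w (b ++ a)) refl)

swapL : Letter → Letter
swapL a⁺ = b⁺
swapL a⁻ = b⁻
swapL b⁺ = a⁺
swapL b⁻ = a⁻

E-∷ : ∀ l w → E (l ∷ w) ≡ swapL l ∷ E w
E-∷ a⁺ w = refl
E-∷ a⁻ w = refl
E-∷ b⁺ w = refl
E-∷ b⁻ w = refl

-- E ∘ R_l = R_{E l} ∘ E: both sides compose to the same substitution.
E-RL : ∀ l z → E (RL l z) ≡ RL (swapL l) (E z)
E-RL a⁺ z = trans (subst-∘ b a a (b ++ a) z) (sym (subst-∘ (a ++ b) b b a z))
E-RL a⁻ z = trans (subst-∘ b a a (b ++ a⁻¹) z) (sym (subst-∘ (a ++ b⁻¹) b b a z))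
E-RL b⁺ z = trans (subst-∘ b a (a ++ b) b z) (sym (subst-∘ a (b ++ a) b a z))
E-RL b⁻ z = trans (subst-∘ b a (a ++ b⁻¹) b z) (sym (subst-∘ a (b ++ a⁻¹) b a z))

E-R : ∀ w x → E (R w x) ≡ R (E w) (E x)
E-R [] x = refl
E-R (l ∷ w) x rewrite E-∷ l w = trans (E-RL l (R w x)) (cong (RL (swapL l)) (E-R w x))

lemma3p1 : (w : Word) →
    (Pal w ≈ a⁻¹ ++ b⁻¹ ++ R w (b ++ a)) × (E (Pal w) ≈ Pal (E w))
lemma3p1 w = Pal-ba w , E-Pal
  where
  open ≡-Reasoning
  E-Pal : E (Pal w) ≈ Pal (E w)
  E-Pal = begin
    reduce (E (Pal w))                          ≡⟨ cong (λ z → reduce (a⁻¹ ++ b⁻¹ ++ z)) (E-R w (a ++ b)) ⟩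
    reduce (a⁻¹ ++ b⁻¹ ++ R (E w) (b ++ a))     ≡⟨ sym (Pal-ba (E w)) ⟩
    reduce (Pal (E w))                          ∎
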